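{- Let $\mathcal{M}_1=(S_1,T_1,\emptyset,\Phi_1)$ and $\mathcal{M}_2=(S_2,T_2,\emptyset,\Phi_2)$ be finite BMTS over an action alphabet $\Sigma$, and let $s\in S_1$, $t\in S_2$. Let $Ap = X_R\uplus X_{T1}\uplus X_{T2}$ with $X_R=S_1\times S_2$, $X_{T1}=T_1$ and $X_{T2}=S_1\times T_2$ (elements of $X_{T2}$ written $(u,v,a,v')$ with $u\in S_1$, $(v,a,v')\in T_2$). For $u\in S_1$ let $\pi_u:\mathcal B(\Sigma\times S_1)\to\mathcal B(Ap)$ be the map replacing each atom $(a,x)$ by the atom $(u,a,x)$ (and commuting with $\mathbf{tt},\neg,\wedge,\vee$), and for $u\in S_1,v\in S_2$ let $\pi_{u,v}:\mathcal B(\Sigma\times S_2)\to\mathcal B(Ap)$ replace each atom $(a,x)$ by $(u,v,a,x)$. Define $$\varphi_{u,v}=\bigwedge_{u^*=(u,a,u')\in X_{T1}}\Big(u^*\Rightarrow\bigvee_{v^*=(u,v,a,v')\in X_{T2}}\big(v^*\wedge (u',v')\big)\Big)\ \wedge\ \bigwedge_{v^*=(u,v,a,v')\in X_{T2}}\Big(v^*\Rightarrow\bigvee_{u^*=(u,a,u')\in X_{T1}}\big(u^*\wedge (u',v')\big)\Big),$$ (where in each inner disjunction the action $a$ is the same as in the outer conjunct), $\psi_{u,v}=\pi_u(\Phi_1(u))\Rightarrow\big(\pi_{u,v}(\Phi_2(v))\wedge\varphi_{u,v}\big)$, and $$\Psi_{s,t}=(s,t)\wedge\bigwedge_{(u,v)\in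 X_R}\big((u,v)\Rightarrow\psi_{u,v}\big).$$ Then $s\le_m t$ if and only if there exists a valuation of the atoms in $X_R$ such that for every valuation of the atoms in $X_{T1}$ there exists a valuation of the atoms in $X_{T2}$ such that the union of these valuations satisfies $\Psi_{s,t}$ (i.e. $\exists X_R\,\forall X_{T1}\,\exists X_{T2}\,\Psi_{s,t}$ is a true quantified Boolean formula).
   Context: Boolean formulae over a set $X$ of atoms: $\varphi::=\mathbf{tt}\mid x\mid\neg\varphi\mid\varphi\wedge\varphi\mid\varphi\vee\varphi$ ($x\in X$); $\mathcal B(X)$ is the set of them; a valuation $\nu\subseteq X$ (the set of true atoms) satisfies formulas in the standard way; $\Rightarrow$ is the usual implication. A BMTS (Boolean modal transition system) over $\Sigma$ is a tuple $(S,T,\emptyset,\Phi)$ with $S$ a set of states, $T\subseteq S\times\Sigma\times S$ a transition relation and $\Phi:S\to\mathcal B(\Sigma\times S)$ an obligation function such that whenever $(a,t)$ occurs in $\Phi(s)$ then $(s,a,t)\in T$. For a state $s$, $T(s)=\{(a,t)\mid (s,a,t)\in T\}$ and $\mathrm{Tran}(s)=\{E\subseteq T(s)\mid E\models\Phi(s)\}$. Modal refinement: $s_0\le_m t_0$ iff $(s_0,t_0)$ belongs to some relation $R\subseteq S_1\times S_2$ such that for every $(s,t)\in R$: for all $M\in\mathrm{Tran}(s)$ there is $N\in\mathrm{Tran}(t)$ such that for every $(a,s')\in M$ there is $(a,t')\in N$ with $(s',t')\in R$, and for every $(a,t')\in N$ there is $(a,s')\in M$ with $(s',t')\in R$. 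-}

module Defs where

open import Data.Nat using (ℕ)
open import Data.Fin using (Fin)
open import Data.Bool using (Bool; true; false; not; _∧_; _∨_)
open import Data.List using (List; []; _∷_; foldr; concatMap; allFin; map)
open import Data.Product using (Σ; _×_; _,_; proj₁; proj₂; ∃)
open import Data.Sum using (_⊎_; inj₁; inj₂; [_,_])
open import Relation.Binary.PropositionalEquality using (_≡_; refl)

data BF (X : Set) : Set where
  tt   : BF X
  atom : X → BF X
  ¬ᶠ_  : BF X → BF X
  _∧ᶠ_ : BF X → BF X → BF X
  _∨ᶠ_ : BF X → BF X → BF X

-- valuations ν ⊆ X are represented by their characteristic functions
eval : {X : Set} → (X → Bool) → BF X → Bool
eval ν tt        = true
eval ν (atom x)  = ν x
eval ν (¬ᶠ φ)    = not (eval ν φ)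
eval ν (φ ∧ᶠ ψ)  = eval ν φ ∧ eval ν ψ
eval ν (φ ∨ᶠ ψ)  = eval ν φ ∨ eval ν ψ

_⊨_ : {X : Set} → (X → Bool) → BF X → Set
ν ⊨ φ = eval ν φ ≡ true

mapBF : {X Y : Set} → (X → Y) → BF X → BF Y
mapBF f tt       = tt
mapBF f (atom x) = atom (f x)
mapBF f (¬ᶠ φ)   = ¬ᶠ mapBF f φ
mapBF f (φ ∧ᶠ ψ) = mapBF f φ ∧ᶠ mapBF f ψ
mapBF f (φ ∨ᶠ ψ) = mapBF f φ ∨ᶠ mapBF f ψ

ff : {X : Set} → BF X
ff = ¬ᶠ tt

_⇒ᶠ_ : {X : Set} → BF X → BF X → BF X
φ ⇒ᶠ ψ = (¬ᶠ φ) ∨ᶠ ψ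

⋀ : {X : Set} → List (BF X) → BF X
⋀ = foldr _∧ᶠ_ tt

⋁ : {X : Set} → List (BF X) → BF X
⋁ = foldr _∨ᶠ_ ff

Out : {k n : ℕ} → (Fin n → Fin k → Fin n → Bool) → Fin n → Set
Out {k} {n} T s = Σ (Fin k × Fin n) λ p → T s (proj₁ p) (proj₂ p) ≡ true

record BMTS (k : ℕ) : Set where
  field
    n : ℕ
    T : Fin n → Fin k → Fin n → Bool
    -- Φ(s) ∈ B(Σ × S) whose atoms all lie in T(s)
    Φ : (s : Fin n) → BF (Out T s)

open BMTS public

Tran : {k : ℕ} (M : BMTS k) → Fin (n M) → Set
Tran M s = Σ (Out (T M) s → Bool) λ E → E ⊨ Φ M s

act : {k n : ℕ} (T : Fin n → Fin k → Fin n → Bool) (s : Fin n) → Out T s → Fin k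
act T s ((a , _) , _) = a

tgt : {k n : ℕ} (T : Fin n → Fin k → Fin n → Bool) (s : Fin n) → Out T s → Fin n
tgt T s ((_ , x) , _) = x

IsModalRefinement : {k : ℕ} (M₁ M₂ : BMTS k) → (Fin (n M₁) → Fin (n M₂) → Set) → Set
IsModalRefinement M₁ M₂ R =
  ∀ u v → R u v →
  ∀ (M : Tran M₁ u) → Σ (Tran M₂ v) λ N →
      (∀ e → proj₁ M e ≡ true →
         Σ (Out (T M₂) v) λ e' → proj₁ N e' ≡ true
           × act (T M₂) v e' ≡ act (T M₁) u e × R (tgt (T M₁) u e) (tgt (T M₂) v e'))
    × (∀ e' → proj₁ N e' ≡ true →
         Σ (Out (T M₁) u) λ e → proj₁ M e ≡ true
           × act (T M₁) u e ≡ act (T M₂) v e' × R (tgt (T M₁) u e) (tgt (T M₂) v e'))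

_≤m_ : {k : ℕ} {M₁ M₂ : BMTS k} → Fin (n M₁) → Fin (n M₂) → Set₁
_≤m_ {k} {M₁} {M₂} s t =
  Σ (Fin (n M₁) → Fin (n M₂) → Set) λ R → R s t × IsModalRefinement M₁ M₂ R

trues : {A : Set} (b : Bool) → (b ≡ true → A) → List A
trues true  f = f refl ∷ []
trues false f = []

module Encoding {k : ℕ} (M₁ M₂ : BMTS k) where
  private
    n₁ = n M₁
    n₂ = n M₂
    T₁ = T M₁
    T₂ = T M₂

  XR : Set
  XR = Fin n₁ × Fin n₂

  XT1 : Set
  XT1 = Σ (Fin n₁ × Fin k × Fin n₁) λ { (u , a , u') → T₁ u a u' ≡ true }

  XT2 : Set
  XT2 = Σ (Fin n₁ × Fin n₂ × Fin k × Fin n₂) λ { (u , v , a , v') → T₂ v a v' ≡ true }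

  Ap : Set
  Ap = XR ⊎ XT1 ⊎ XT2

  r : Fin n₁ → Fin n₂ → BF Ap
  r u v = atom (inj₁ (u , v))

  π₁ : (u : Fin n₁) → BF (Out T₁ u) → BF Ap
  π₁ u = mapBF λ { ((a , x) , p) → inj₂ (inj₁ ((u , a , x) , p)) }

  π₂ : (u : Fin n₁) (v : Fin n₂) → BF (Out T₂ v) → BF Ap
  π₂ u v = mapBF λ { ((a , x) , q) → inj₂ (inj₂ ((u , v , a , x) , q)) }

  succ₁ : (u : Fin n₁) (a : Fin k) → List (Σ (Fin n₁) λ u' → T₁ u a u' ≡ true)
  succ₁ u a = concatMap (λ u' → trues (T₁ u a u') (λ p → (u' , p))) (allFin n₁)

  succ₂ : (v : Fin n₂) (a : Fin k) → List (Σ (Fin n₂) λ v' → T₂ v a v' ≡ true)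
  succ₂ v a = concatMap (λ v' → trues (T₂ v a v') (λ q → (v' , q))) (allFin n₂)

  φ : Fin n₁ → Fin n₂ → BF Ap
  φ u v =
      ⋀ (concatMap (λ a → map (λ { (u' , p) →
            atom (inj₂ (inj₁ ((u , a , u') , p))) ⇒ᶠ
              ⋁ (map (λ { (v' , q) → atom (inj₂ (inj₂ ((u , v , a , v') , q))) ∧ᶠ r u' v' })
                     (succ₂ v a)) })
          (succ₁ u a)) (allFin k))
    ∧ᶠ
      ⋀ (concatMap (λ a → map (λ { (v' , q) →
            atom (inj₂ (inj₂ ((u , v , a , v') , q))) ⇒ᶠ
              ⋁ (map (λ { (u' , p) → atom (inj₂ (inj₁ ((u , a , u') , p))) ∧ᶠ r u' v' })
                     (succ₁ u a)) })
          (succ₂ v a)) (allFin k))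

  ψ : Fin n₁ → Fin n₂ → BF Ap
  ψ u v = π₁ u (Φ M₁ u) ⇒ᶠ (π₂ u v (Φ M₂ v) ∧ᶠ φ u v)

  Ψ : Fin n₁ → Fin n₂ → BF Ap
  Ψ s t = r s t ∧ᶠ ⋀ (concatMap (λ u → map (λ v → r u v ⇒ᶠ ψ u v) (allFin n₂)) (allFin n₁))

  QBFtrue : Fin n₁ → Fin n₂ → Set
  QBFtrue s t =
    ∃ λ (νR : XR → Bool) → ∀ (νT1 : XT1 → Bool) → ∃ λ (νT2 : XT2 → Bool) →
      [ νR , [ νT1 , νT2 ] ] ⊨ Ψ s t

module Submission where

-- Under a valuation, an atom (u , v) of X_R says that u is related to v, the atoms of X_T1 choose a
-- set M of transitions of every u, and the atoms (u , v , a , v′) of X_T2 choose a set N of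
-- transitions of v as the answer to M for the pair (u , v).  Unfolding Ψ s t, a valuation satisfies
-- it iff (s , t) is related and, for every related pair, M ∈ Tran u forces N ∈ Tran v with N
-- matching M along the relation; so ∃ X_R ∀ X_T1 ∃ X_T2 Ψ s t restates the definition of a modal
-- refinement containing (s , t).
-- Constructively the relation witnessing s ≤m t need not be decidable, so it does not directly give
-- a valuation of X_R.  But valuations of finite sets of atoms can be searched, so the QBF is
-- decidable, hence ¬¬-stable, and under ¬¬ we may assume the relation decidable.

open import Defs
open import Axiom.UniquenessOfIdentityProofs using (module Decidable⇒UIP)
open import Data.Bool using (Bool; true; false; not; _∧_; _∨_)
import Data.Bool.Properties as Bool
open import Data.Empty using (⊥-elim)
open import Data.Fin using (Fin; combine; remQuot)
open import Data.Fin.Properties as Fin using (remQuot-combine; sequence)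
open import Data.Fin.Subset using (Subset)
open import Data.Fin.Subset.Properties using (anySubset?)
open import Data.List using (List; []; _∷_; concatMap; allFin; map)
open import Data.List.Membership.Propositional using (_∈_; lose)
open import Data.List.Membership.Propositional.Properties using (∈-allFin; ∈-concatMap⁺)
open import Data.List.Relation.Unary.All as All using (All; []; _∷_)
import Data.List.Relation.Unary.All.Properties as All
open import Data.List.Relation.Unary.Any as Any using (Any; here; there)
import Data.List.Relation.Unary.Any.Properties as Any
open import Data.Maybe as Maybe using (Maybe; just; maybe′; _>>=_)
open import Data.Nat using (ℕ; _*_)
open import Data.Product using (Σ; _×_; _,_; proj₁; proj₂; ∃; ∃₂; uncurry)
open import Data.Sum using (_⊎_; inj₁; inj₂; [_,_])
open import Data.Sum.Properties using ([,]-cong)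
open import Data.Vec using (lookup; tabulate)
open import Data.Vec.Properties using (lookup∘tabulate)
open import Effect.Monad using (RawMonad)
open import Function.Base using (_∘_; id; case_of_)
open import Function.Bundles using (_⇔_; mk⇔; Equivalence)
open import Relation.Binary.Definitions using (_Respects_)
open import Relation.Binary.PropositionalEquality using (_≡_; refl; _≗_; cong; cong₂; trans; sym)
open import Relation.Nullary using (Dec; yes; no; ¬_; ¬?)
open import Relation.Nullary.Decidable
  using (map′; isYes; toWitness; fromWitness; dec⇒maybe; dec-yes-irr; decidable-stable;
         ¬¬-excluded-middle)
open import Relation.Nullary.Negation using (¬¬-Monad)
open import Relation.Unary using (Decidable; Irrelevant)

open Equivalence using (to; from)

∧≡true⇔ : ∀ {x y} → x ∧ y ≡ true ⇔ (x ≡ true × y ≡ true)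
∧≡true⇔ {true}  = mk⇔ (refl ,_) proj₂
∧≡true⇔ {false} = mk⇔ (λ ()) (λ ())

∨≡true⇔ : ∀ {x y} → x ∨ y ≡ true ⇔ (x ≡ true ⊎ y ≡ true)
∨≡true⇔ {true}  = mk⇔ inj₁ (λ _ → refl)
∨≡true⇔ {false} = mk⇔ inj₂ (λ { (inj₁ ()) ; (inj₂ y) → y })

not∨≡true⇔ : ∀ {x y} → not x ∨ y ≡ true ⇔ (x ≡ true → y ≡ true)
not∨≡true⇔ {true}  = mk⇔ (λ y _ → y) (λ f → f refl)
not∨≡true⇔ {false} = mk⇔ (λ _ ()) (λ _ → refl)

module _ {X : Set} (ν : X → Bool) where

  ⊨-⋀ : ∀ {φs} → ν ⊨ ⋀ φs ⇔ All (ν ⊨_) φs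
  ⊨-⋀ {[]}     = mk⇔ (λ _ → []) (λ _ → refl)
  ⊨-⋀ {φ ∷ φs} = mk⇔ (λ h → let (hφ , hφs) = ∧≡true⇔ .to h in hφ ∷ ⊨-⋀ .to hφs)
                     (λ { (hφ ∷ hφs) → ∧≡true⇔ .from (hφ , ⊨-⋀ .from hφs) })

  ⊨-⋁ : ∀ {φs} → ν ⊨ ⋁ φs ⇔ Any (ν ⊨_) φs
  ⊨-⋁ {[]}     = mk⇔ (λ ()) (λ ())
  ⊨-⋁ {φ ∷ φs} = mk⇔ split join
    where
    split : ν ⊨ ⋁ (φ ∷ φs) → Any (ν ⊨_) (φ ∷ φs)
    split h with ∨≡true⇔ .to h
    ... | inj₁ hφ  = here hφ
    ... | inj₂ hφs = there (⊨-⋁ .to hφs)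
    join : Any (ν ⊨_) (φ ∷ φs) → ν ⊨ ⋁ (φ ∷ φs)
    join (here hφ)   = ∨≡true⇔ .from (inj₁ hφ)
    join (there hφs) = ∨≡true⇔ .from (inj₂ (⊨-⋁ .from hφs))

  ⊨-⋀-grid : ∀ {m} {B : Fin m → Set} {g : ∀ a → B a → BF X} {xs : ∀ a → List (B a)} →
    ν ⊨ ⋀ (concatMap (λ a → map (g a) (xs a)) (allFin m)) ⇔ (∀ a → All (λ y → ν ⊨ g a y) (xs a))
  ⊨-⋀-grid = mk⇔
    (λ h a → All.map⁻ (All.tabulate⁻ (All.map⁻ (All.concat⁻ (⊨-⋀ .to h))) a))
    (λ h → ⊨-⋀ .from (All.concat⁺ (All.map⁺ (All.tabulate⁺ λ a → All.map⁺ (h a)))))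

eval-cong : ∀ {X} {ν ν′ : X → Bool} → ν ≗ ν′ → ∀ φ → eval ν φ ≡ eval ν′ φ
eval-cong e tt       = refl
eval-cong e (atom x) = e x
eval-cong e (¬ᶠ φ)   = cong not (eval-cong e φ)
eval-cong e (φ ∧ᶠ ψ) = cong₂ _∧_ (eval-cong e φ) (eval-cong e ψ)
eval-cong e (φ ∨ᶠ ψ) = cong₂ _∨_ (eval-cong e φ) (eval-cong e ψ)

⊨-cong : ∀ {X} {ν ν′ : X → Bool} → ν ≗ ν′ → ∀ φ → ν ⊨ φ → ν′ ⊨ φ
⊨-cong e φ h = trans (sym (eval-cong e φ)) h

eval-mapBF : ∀ {X Y} (ν : Y → Bool) (f : X → Y) φ → eval ν (mapBF f φ) ≡ eval (ν ∘ f) φ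
eval-mapBF ν f tt       = refl
eval-mapBF ν f (atom x) = refl
eval-mapBF ν f (¬ᶠ φ)   = cong not (eval-mapBF ν f φ)
eval-mapBF ν f (φ ∧ᶠ ψ) = cong₂ _∧_ (eval-mapBF ν f φ) (eval-mapBF ν f ψ)
eval-mapBF ν f (φ ∨ᶠ ψ) = cong₂ _∨_ (eval-mapBF ν f φ) (eval-mapBF ν f ψ)

module _ {A : Set} where

  ∈-trues : ∀ {b} {f : b ≡ true → A} (p : b ≡ true) → f p ∈ trues b f
  ∈-trues refl = here refl

  All-trues : ∀ {P : A → Set} b {f : b ≡ true → A} → (∀ p → P (f p)) → All P (trues b f)
  All-trues true  h = h refl ∷ []
  All-trues false h = []

successors : ∀ {k n} (T : Fin n → Fin k → Fin n → Bool) (s : Fin n) (a : Fin k) →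
             List (Σ (Fin n) λ x → T s a x ≡ true)
successors {n = n} T s a = concatMap (λ x → trues (T s a x) (x ,_)) (allFin n)

module _ {k n} (T : Fin n → Fin k → Fin n → Bool) (s : Fin n) {a : Fin k} where

  ∈-successors : ∀ {x} (p : T s a x ≡ true) → (x , p) ∈ successors T s a
  ∈-successors {x} p = ∈-concatMap⁺ _ (lose (∈-allFin x) (∈-trues p))

  All-successors : ∀ {P : (Σ (Fin n) λ x → T s a x ≡ true) → Set} →
                   All P (successors T s a) ⇔ (∀ x p → P (x , p))
  All-successors = mk⇔
    (λ h x p → All.lookup h (∈-successors p))
    (λ h → All.concat⁺ (All.map⁺ (All.tabulate⁺ λ x → All-trues (T s a x) (h x))))

  ⊨-⋁-successors : ∀ {X} {ν : X → Bool} {g : (Σ (Fin n) λ x → T s a x ≡ true) → BF X} →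
    ν ⊨ ⋁ (map g (successors T s a)) ⇔ ∃₂ λ x p → ν ⊨ g (x , p)
  ⊨-⋁-successors {ν = ν} = mk⇔
    (λ h → let (x , p) , w = Any.satisfied (Any.map⁻ {xs = successors T s a} (⊨-⋁ ν .to h))
           in x , p , w)
    (λ { (x , p , w) → ⊨-⋁ ν .from (Any.map⁺ (lose (∈-successors p) w)) })

¬¬-∀-Fin : ∀ {m} {P : Fin m → Set} → (∀ i → ¬ ¬ P i) → ¬ ¬ (∀ i → P i)
¬¬-∀-Fin = sequence (RawMonad.rawApplicative ¬¬-Monad)

-- X embeds into Fin size with a partial inverse, so a valuation X → Bool is determined, up to ≗,
-- by a subset of Fin size.
record Finite (X : Set) : Set where
  field
    size         : ℕ
    index        : X → Fin size
    decode       : Fin size → Maybe X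
    decode-index : ∀ x → decode (index x) ≡ just x

open Finite

Fin-finite : ∀ m → Finite (Fin m)
Fin-finite m = record { size = m ; index = id ; decode = just ; decode-index = λ _ → refl }

×-finite : ∀ {A B} → Finite A → Finite B → Finite (A × B)
×-finite FA FB = record
  { size         = size FA * size FB
  ; index        = λ (x , y) → combine (index FA x) (index FB y)
  ; decode       = decode×
  ; decode-index = λ (x , y) →
      trans (cong (uncurry decodes) (remQuot-combine (index FA x) (index FB y)))
            (cong₂ Maybe.zip (decode-index FA x) (decode-index FB y))
  }
  where
  decodes : Fin (size FA) → Fin (size FB) → Maybe _
  decodes i j = Maybe.zip (decode FA i) (decode FB j)
  decode× : Fin (size FA * size FB) → Maybe _
  decode× = uncurry decodes ∘ remQuot (size FB)

Σ-finite : ∀ {A} {P : A → Set} → Finite A → Decidable P → Irrelevant P → Finite (Σ A P)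
Σ-finite {P = P} FA P? P-irr = record
  { size         = size FA
  ; index        = index FA ∘ proj₁
  ; decode       = λ i → decode FA i >>= refine
  ; decode-index = λ (x , p) →
      trans (cong (_>>= refine) (decode-index FA x))
            (cong (Maybe.map (x ,_) ∘ dec⇒maybe) (dec-yes-irr (P? x) P-irr p))
  }
  where
  refine : ∀ x → Maybe (Σ _ P)
  refine x = Maybe.map (x ,_) (dec⇒maybe (P? x))

module _ {X : Set} (F : Finite X) {P : (X → Bool) → Set}
         (P-resp : P Respects _≗_) (P? : Decidable P) where

  private
    fromSubset : Subset (size F) → X → Bool
    fromSubset bs = lookup bs ∘ index F

    toSubset : (X → Bool) → Subset (size F)
    toSubset f = tabulate (maybe′ f false ∘ decode F)

    fromSubset-toSubset : ∀ f → fromSubset (toSubset f) ≗ f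
    fromSubset-toSubset f x =
      trans (lookup∘tabulate _ (index F x)) (cong (maybe′ f false) (decode-index F x))

  ∃-valuation? : Dec (∃ P)
  ∃-valuation? = map′ (λ (bs , p) → fromSubset bs , p)
                      (λ (f , p) → toSubset f , P-resp (sym ∘ fromSubset-toSubset f) p)
                      (anySubset? (P? ∘ fromSubset))

∀-valuation? : ∀ {X} (F : Finite X) {P : (X → Bool) → Set} →
               P Respects _≗_ → Decidable P → Dec (∀ f → P f)
∀-valuation? F P-resp P? = map′
  (λ ∄¬P f → decidable-stable (P? f) (λ ¬Pf → ∄¬P (f , ¬Pf)))
  (λ ∀P (f , ¬Pf) → ¬Pf (∀P f))
  (¬? (∃-valuation? F (λ f≗g ¬Pf Pg → ¬Pf (P-resp (sym ∘ f≗g) Pg)) (¬? ∘ P?)))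

module Refinement {k} (M₁ M₂ : BMTS k) where
  open Encoding M₁ M₂

  private
    n₁ = n M₁
    n₂ = n M₂
    T₁ = T M₁
    T₂ = T M₂

  module _ (R : Fin n₁ → Fin n₂ → Set) {u : Fin n₁} {v : Fin n₂} where

    Forth Back Matching : (Out T₁ u → Bool) → (Out T₂ v → Bool) → Set
    Forth E N = ∀ e → E e ≡ true → Σ (Out T₂ v) λ e′ →
      N e′ ≡ true × act T₂ v e′ ≡ act T₁ u e × R (tgt T₁ u e) (tgt T₂ v e′)
    Back E N = ∀ e′ → N e′ ≡ true → Σ (Out T₁ u) λ e →
      E e ≡ true × act T₁ u e ≡ act T₂ v e′ × R (tgt T₁ u e) (tgt T₂ v e′)
    Matching E N = Forth E N × Back E N

  Matching-map : ∀ {R R′ : Fin n₁ → Fin n₂ → Set} {u v}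
                   {E E′ : Out T₁ u → Bool} {N N′ : Out T₂ v → Bool} →
    (∀ {x y} → R x y → R′ x y) → E ≗ E′ → N ≗ N′ → Matching R E N → Matching R′ E′ N′
  Matching-map R⇒R′ E≗E′ N≗N′ (forth , back) =
    (λ e E′e → let e′ , Ne′ , same , r = forth e (trans (E≗E′ e) E′e)
               in e′ , trans (sym (N≗N′ e′)) Ne′ , same , R⇒R′ r) ,
    (λ e′ N′e′ → let e , Ee , same , r = back e′ (trans (N≗N′ e′) N′e′)
                 in e , trans (sym (E≗E′ e)) Ee , same , R⇒R′ r)

  Related : (XR → Bool) → Fin n₁ → Fin n₂ → Set
  Related νR u v = νR (u , v) ≡ true

  chosen₁ : (XT1 → Bool) → (u : Fin n₁) → Out T₁ u → Bool
  chosen₁ νT1 u ((a , x) , p) = νT1 ((u , a , x) , p)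

  chosen₂ : (XT2 → Bool) → (u : Fin n₁) (v : Fin n₂) → Out T₂ v → Bool
  chosen₂ νT2 u v ((a , x) , q) = νT2 ((u , v , a , x) , q)

  module Valuation (νR : XR → Bool) (νT1 : XT1 → Bool) (νT2 : XT2 → Bool) where

    ν : Ap → Bool
    ν = [ νR , [ νT1 , νT2 ] ]

    ⊨-φ : ∀ {u v} → ν ⊨ φ u v ⇔ Matching (Related νR) (chosen₁ νT1 u) (chosen₂ νT2 u v)
    ⊨-φ {u} {v} = mk⇔ sound complete
      where
      sound : ν ⊨ φ u v → Matching (Related νR) (chosen₁ νT1 u) (chosen₂ νT2 u v)
      sound h = forth , back
        where
        forth : Forth (Related νR) (chosen₁ νT1 u) (chosen₂ νT2 u v)
        forth ((a , u′) , p) e =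
          let clause = All-successors T₁ u .to (⊨-⋀-grid ν .to (proj₁ (∧≡true⇔ .to h)) a) u′ p
              v′ , q , w = ⊨-⋁-successors T₂ v .to (not∨≡true⇔ .to clause e)
              w₁ , w₂ = ∧≡true⇔ .to w
          in ((a , v′) , q) , w₁ , refl , w₂
        back : Back (Related νR) (chosen₁ νT1 u) (chosen₂ νT2 u v)
        back ((a , v′) , q) e =
          let clause = All-successors T₂ v .to (⊨-⋀-grid ν .to (proj₂ (∧≡true⇔ .to h)) a) v′ q
              u′ , p , w = ⊨-⋁-successors T₁ u .to (not∨≡true⇔ .to clause e)
              w₁ , w₂ = ∧≡true⇔ .to w
          in ((a , u′) , p) , w₁ , refl , w₂
      complete : Matching (Related νR) (chosen₁ νT1 u) (chosen₂ νT2 u v) → ν ⊨ φ u v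
      complete (forth , back) = ∧≡true⇔ .from
        ( ⊨-⋀-grid ν .from (λ a → All-successors T₁ u .from λ u′ p → not∨≡true⇔ .from λ e →
            case forth ((a , u′) , p) e of λ where
              (((_ , v′) , q) , w₁ , refl , w₂) →
                ⊨-⋁-successors T₂ v .from (v′ , q , ∧≡true⇔ .from (w₁ , w₂)))
        , ⊨-⋀-grid ν .from (λ a → All-successors T₂ v .from λ v′ q → not∨≡true⇔ .from λ e →
            case back ((a , v′) , q) e of λ where
              (((_ , u′) , p) , w₁ , refl , w₂) →
                ⊨-⋁-successors T₁ u .from (u′ , p , ∧≡true⇔ .from (w₁ , w₂))))

    Answered : Fin n₁ → Fin n₂ → Set
    Answered u v = chosen₁ νT1 u ⊨ Φ M₁ u →
      chosen₂ νT2 u v ⊨ Φ M₂ v × Matching (Related νR) (chosen₁ νT1 u) (chosen₂ νT2 u v)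

    ⊨-ψ : ∀ {u v} → ν ⊨ ψ u v ⇔ Answered u v
    ⊨-ψ {u} {v} = mk⇔
      (λ h hΦ₁ →
        let hΦ₂ , hφ = ∧≡true⇔ .to (not∨≡true⇔ .to h (trans (eval-mapBF ν _ (Φ M₁ u)) hΦ₁))
        in trans (sym (eval-mapBF ν _ (Φ M₂ v))) hΦ₂ , ⊨-φ .to hφ)
      (λ f → not∨≡true⇔ .from λ hΦ₁ →
        let hΦ₂ , m = f (trans (sym (eval-mapBF ν _ (Φ M₁ u))) hΦ₁)
        in ∧≡true⇔ .from (trans (eval-mapBF ν _ (Φ M₂ v)) hΦ₂ , ⊨-φ .from m))

    ⊨-Ψ : ∀ {s t} → ν ⊨ Ψ s t ⇔ (Related νR s t × ∀ u v → Related νR u v → Answered u v)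
    ⊨-Ψ = mk⇔
      (λ h → let hst , hall = ∧≡true⇔ .to h in
        hst , λ u v huv → ⊨-ψ .to (not∨≡true⇔ .to (All.tabulate⁻ (⊨-⋀-grid ν .to hall u) v) huv))
      (λ { (hst , f) → ∧≡true⇔ .from (hst , ⊨-⋀-grid ν .from λ u →
        All.tabulate⁺ λ v → not∨≡true⇔ .from (⊨-ψ .from ∘ f u v)) })

  ⊨Ψ-cong : ∀ {νR νR′ νT1 νT1′ νT2 νT2′ s t} → νR ≗ νR′ → νT1 ≗ νT1′ → νT2 ≗ νT2′ →
    [ νR , [ νT1 , νT2 ] ] ⊨ Ψ s t → [ νR′ , [ νT1′ , νT2′ ] ] ⊨ Ψ s t
  ⊨Ψ-cong {s = s} {t} eR e₁ e₂ = ⊨-cong ([,]-cong eR ([,]-cong e₁ e₂)) (Ψ s t)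

  XR-finite : Finite XR
  XR-finite = ×-finite (Fin-finite n₁) (Fin-finite n₂)

  XT1-finite : Finite XT1
  XT1-finite = Σ-finite (×-finite (Fin-finite n₁) (×-finite (Fin-finite k) (Fin-finite n₁)))
    (λ (u , a , u′) → T₁ u a u′ Bool.≟ true) (Decidable⇒UIP.≡-irrelevant Bool._≟_)

  XT2-finite : Finite XT2
  XT2-finite = Σ-finite
    (×-finite (Fin-finite n₁) (×-finite (Fin-finite n₂) (×-finite (Fin-finite k) (Fin-finite n₂))))
    (λ (u , v , a , v′) → T₂ v a v′ Bool.≟ true) (Decidable⇒UIP.≡-irrelevant Bool._≟_)

  QBFtrue? : ∀ s t → Dec (QBFtrue s t)
  QBFtrue? s t =
    ∃-valuation? XR-finite
      (λ eR win νT1 → let νT2 , h = win νT1 in νT2 , ⊨Ψ-cong eR (λ _ → refl) (λ _ → refl) h)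
      λ νR → ∀-valuation? XT1-finite (λ e₁ (νT2 , h) → νT2 , ⊨Ψ-cong (λ _ → refl) e₁ (λ _ → refl) h)
      λ νT1 → ∃-valuation? XT2-finite (⊨Ψ-cong (λ _ → refl) (λ _ → refl))
      λ νT2 → eval [ νR , [ νT1 , νT2 ] ] (Ψ s t) Bool.≟ true

  focus : (u : Fin n₁) → (Out T₁ u → Bool) → XT1 → Bool
  focus u E ((u′ , a , x) , p) with u′ Fin.≟ u
  ... | yes refl = E ((a , x) , p)
  ... | no _     = false

  chosen₁-focus : ∀ u E → chosen₁ (focus u E) u ≗ E
  chosen₁-focus u E ((a , x) , p)
    rewrite dec-yes-irr (u Fin.≟ u) (Decidable⇒UIP.≡-irrelevant Fin._≟_) refl = refl

  QBF⇒≤m : ∀ {s t} → QBFtrue s t → _≤m_ {k} {M₁} {M₂} s t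
  QBF⇒≤m {s} {t} (νR , win) = Related νR , sRt , refines
    where
    sRt : Related νR s t
    sRt = let νT2 , h = win (λ _ → false) in proj₁ (Valuation.⊨-Ψ νR _ νT2 .to h)

    refines : IsModalRefinement M₁ M₂ (Related νR)
    refines u v uRv (E , E⊨Φ) =
      let νT1 = focus u E
          νT2 , h = win νT1
          N⊨Φ , m = proj₂ (Valuation.⊨-Ψ νR νT1 νT2 .to h) u v uRv
                      (⊨-cong (sym ∘ chosen₁-focus u E) (Φ M₁ u) E⊨Φ)
      in (chosen₂ νT2 u v , N⊨Φ) , Matching-map id (chosen₁-focus u E) (λ _ → refl) m

  module _ {R : Fin n₁ → Fin n₂ → Set} (ref : IsModalRefinement M₁ M₂ R)
           (R? : ∀ u v → Dec (R u v)) where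

    characteristic : XR → Bool
    characteristic (u , v) = isYes (R? u v)

    Related-characteristic : ∀ {u v} → Related characteristic u v ⇔ R u v
    Related-characteristic = mk⇔ (toWitness ∘ Bool.T-≡ .from) (Bool.T-≡ .to ∘ fromWitness)

    module _ (νT1 : XT1 → Bool) where

      response : ∀ {u v} → Dec (R u v) → Dec (chosen₁ νT1 u ⊨ Φ M₁ u) → Out T₂ v → Bool
      response {u} {v} (yes uRv) (yes E⊨Φ) = proj₁ (proj₁ (ref u v uRv (chosen₁ νT1 u , E⊨Φ)))
      response         _         _         = λ _ → false

      response-answers : ∀ {u v} (uRv? : Dec (R u v)) (E⊨Φ? : Dec (chosen₁ νT1 u ⊨ Φ M₁ u)) →
        R u v → chosen₁ νT1 u ⊨ Φ M₁ u →
        response uRv? E⊨Φ? ⊨ Φ M₂ v × Matching R (chosen₁ νT1 u) (response uRv? E⊨Φ?)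
      response-answers {u} {v} (yes uRv) (yes E⊨Φ) _ _ =
        let (_ , N⊨Φ) , m = ref u v uRv (chosen₁ νT1 u , E⊨Φ) in N⊨Φ , m
      response-answers (no ¬uRv) _          uRv _   = ⊥-elim (¬uRv uRv)
      response-answers (yes _)   (no ¬E⊨Φ) _   E⊨Φ = ⊥-elim (¬E⊨Φ E⊨Φ)

      respond : XT2 → Bool
      respond ((u , v , a , x) , q) =
        response (R? u v) (eval (chosen₁ νT1 u) (Φ M₁ u) Bool.≟ true) ((a , x) , q)

      respond-answers : ∀ u v → Related characteristic u v →
                        Valuation.Answered characteristic νT1 respond u v
      respond-answers u v uRv E⊨Φ =
        let N⊨Φ , m = response-answers (R? u v) (eval (chosen₁ νT1 u) (Φ M₁ u) Bool.≟ true)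
                        (Related-characteristic .to uRv) E⊨Φ
        in N⊨Φ , Matching-map (Related-characteristic .from) (λ _ → refl) (λ _ → refl) m

    refinement⇒QBF : ∀ {s t} → R s t → QBFtrue s t
    refinement⇒QBF sRt = characteristic , λ νT1 →
      respond νT1 , Valuation.⊨-Ψ characteristic νT1 (respond νT1) .from
                      (Related-characteristic .from sRt , respond-answers νT1)

  ≤m⇒QBF : ∀ {s t} → _≤m_ {k} {M₁} {M₂} s t → QBFtrue s t
  ≤m⇒QBF {s} {t} (R , sRt , ref) = decidable-stable (QBFtrue? s t) λ ¬qbf →
    ¬¬-∀-Fin (λ u → ¬¬-∀-Fin (λ v → ¬¬-excluded-middle)) λ R? → ¬qbf (refinement⇒QBF ref R? sRt)

theorem1 : ∀ {k} (M₁ M₂ : BMTS k) (s : Fin (n M₁)) (t : Fin (n M₂)) →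
    (_≤m_ {k} {M₁} {M₂} s t) ⇔ Encoding.QBFtrue M₁ M₂ s t
theorem1 M₁ M₂ s t = mk⇔ ≤m⇒QBF QBF⇒≤m
  where open Refinement M₁ M₂
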